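{- Let $n\ge1$, $k\ge1$, $w\in\mathfrak{S}_n$, and $d$ an integer with $0<d<kn$; let $m=kn/\gcd(kn,d)$. The number of $(w,g^d)$-equivariant functions $f:[n]\to[kn]\cup\{0\}$ equals $(kn+1)^{r_m(w)}$, where $r_m(w)$ is the number of cycles of $w$ whose length is divisible by $m$.
   Context: Identify $g$ with the permutation of $[kn]\cup\{0\}$ that cyclically permutes $1\to2\to\cdots\to kn\to1$ and fixes $0$. A function $f:[n]\to[kn]\cup\{0\}$ is called $(w,g^d)$-equivariant if $f(w(j))=g^d(f(j))$ for all $j\in[n]$. -}

module Defs where

open import Data.Nat using (ℕ; zero; suc; _+_; _*_; _≤_; _≤?_)
open import Data.Nat.Divisibility using (_∣?_)
open import Relation.Nullary using (yes; no)
open import Relation.Binary.PropositionalEquality using (_≡_)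
import Data.List.Relation.Unary.All
open import Data.Nat.DivMod using (_%_; m%n<n)
open import Data.Fin using (Fin; zero; suc; toℕ; fromℕ<; _≟_)
open import Data.Fin.Permutation using (Permutation′; _⟨$⟩ʳ_)
open import Data.List using (List; []; _∷_; map; concatMap; filter; length; allFin; upTo; applyUpTo)
open import Data.List.Relation.Unary.All using (all?)
open import Data.Vec using (Vec; []; _∷_; lookup)
open import Data.Product using (_×_)
open import Relation.Nullary.Decidable using (_×-dec_)

iter : ∀ {A : Set} → (A → A) → ℕ → A → A
iter f zero x = x
iter f (suc t) x = f (iter f t x)

-- The cyclic permutation g of [N] ∪ {0}: Fin (suc N), where 'zero' is 0 and
-- 'suc i' (i : Fin N) is the element toℕ i + 1 of [N].  g fixes 0 and sends
-- 1 → 2 → ⋯ → N → 1.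
g : ∀ N → Fin (suc N) → Fin (suc N)
g zero x = x
g (suc N) zero = zero
g (suc N) (suc i) = suc (fromℕ< (m%n<n (suc (toℕ i)) (suc N)))

gpow : ∀ N → ℕ → Fin (suc N) → Fin (suc N)
gpow N d = iter (g N) d

app : ∀ {n} → Permutation′ n → Fin n → Fin n
app w j = w ⟨$⟩ʳ j

-- Length of the cycle of w containing j: the least t ∈ {1,…,n} with w^t(j) = j
-- (it exists since cycles have length ≤ n). Search with fuel n.
cycleLenFrom : ∀ {n} → Permutation′ n → Fin n → ℕ → ℕ → ℕ
cycleLenFrom w j t zero = t
cycleLenFrom w j t (suc fuel) with iter (app w) t j ≟ j
... | yes _ = t
... | no _ = cycleLenFrom w j (suc t) fuel

cycleLen : ∀ {n} → Permutation′ n → Fin n → ℕ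
cycleLen {n} w j = cycleLenFrom w j 1 n

orbit : ∀ {n} → Permutation′ n → Fin n → List (Fin n)
orbit {n} w j = applyUpTo (λ t → iter (app w) t j) n

isLeader : ∀ {n} → Permutation′ n → Fin n → Set
isLeader w j = Data.List.Relation.Unary.All.All (λ x → toℕ j ≤ toℕ x) (orbit w j)

-- r_m(w): number of cycles of w whose length is divisible by m
-- (each cycle counted once, via its least element)
r : ∀ {n} → ℕ → Permutation′ n → ℕ
r {n} m w = length (filter (λ j → all? (λ x → toℕ j ≤? toℕ x) (orbit w j)
                                   ×-dec (m ∣? cycleLen w j)) (allFin n))

-- all functions [n] → A, encoded as vectors (f j = lookup v j)
allVecs : ∀ {A : Set} → List A → (n : ℕ) → List (Vec A n)
allVecs as zero = [] ∷ []
allVecs as (suc n) = concatMap (λ a → map (a ∷_) (allVecs as n)) as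

Equivariant : ∀ {n} N → Permutation′ n → ℕ → Vec (Fin (suc N)) n → Set
Equivariant {n} N w d f =
  ∀ (j : Fin n) → lookup f (app w j) ≡ gpow N d (lookup f j)

countEquiv : ∀ {n} N → Permutation′ n → ℕ → ℕ
countEquiv {n} N w d =
  length (filter (λ f → all? (λ j → lookup f (app w j) ≟ gpow N d (lookup f j)) (allFin n))
                 (allVecs (allFin (suc N)) n))

module Submission where

-- Cut [n] into the cycles of w and let the leader of a cycle be its least element.
-- An equivariant f is determined by its values at the leaders: on a cycle of length L
-- with leader ℓ, f (w^e ℓ) = G^e (f ℓ), and this is consistent exactly when f ℓ is a
-- point of period dividing L for G = g^d.  Listing f coordinate by coordinate, every
-- coordinate is constrained only by earlier ones (a leader precedes its cycle), so the
-- number of equivariant maps is a product over the coordinates: the number of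
-- G^L-periodic points at each leader, and 1 elsewhere (EquivariantCount, valid for any
-- self-map G of [K] ∪ {0}).  For the shift g on [N] ∪ {0}, g^(Ld) fixes all N + 1 points
-- when N ∣ Ld and only 0 otherwise, and N ∣ Ld ⇔ m ∣ L for m = N / gcd(N, d).  The
-- product is therefore (N + 1)^(r_m(w)).

open import Defs
open import Data.Bool using (true; false; if_then_else_)
open import Data.Empty using (⊥-elim)
open import Data.Fin using (Fin; zero; suc; toℕ; fromℕ<; _≟_)
open import Data.Fin.Permutation using (Permutation′; _⟨$⟩ˡ_; inverseˡ)
open import Data.Fin.Properties
  using (suc-injective; toℕ-injective; toℕ-fromℕ<; toℕ<n; pigeonhole) renaming (all? to allFin?)
open import Data.List using (List; []; _∷_; _++_; map; concatMap; filter; length; tabulate; allFin)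
open import Data.List.Membership.Propositional using (_∈_)
open import Data.List.Membership.Propositional.Properties using (∈-applyUpTo⁺; ∈-applyUpTo⁻)
open import Data.List.Properties
  using (filter-≐; filter-++; filter-all; filter-none; filter-accept; length-++; length-tabulate; map-tabulate)
open import Data.List.Relation.Unary.All as All using (All; all?; universal)
open import Data.List.Relation.Unary.All.Properties using (tabulate⁺; tabulate⁻)
open import Data.Nat
  using (ℕ; zero; suc; _+_; _*_; _^_; _∸_; _≤_; _<_; _≤?_; s≤s; s≤s⁻¹; NonZero; ≢-nonZero; >-nonZero; _%_; _/_)
open import Data.Nat.Coprimality using (Coprime; coprime-/gcd; coprime-divisor)
open import Data.Nat.DivMod
  using (m≡m%n+[m/n]*n; m%n<n; m<n⇒m%n≡m; %-distribˡ-+; m%n%n≡m%n; [m+kn]%n≡m%n; m*n/n≡m; m/n*n≡m)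
open import Data.Nat.Divisibility using (_∣_; divides; _∣?_; ∣-trans; ∣-refl; m∣m*n; *-pres-∣; *-cancelʳ-∣)
open import Data.Nat.GCD using (gcd; gcd[m,n]∣n; gcd[m,n]≢0)
open import Data.Nat.ListAction using (sum; product)
open import Data.Nat.Properties
  using ( +-identityʳ; +-comm; +-suc; +-cancelˡ-≡; *-comm; *-assoc; *-suc
        ; ≤-refl; ≤-trans; ≤-antisym; <⇒≤; ≤-<-trans; <-irrefl; <-cmp; ≤-<-connex; n<1+n
        ; m≤n⇒m<n∨m≡n; m∸n+n≡m; m<n⇒0<n∸m; m∸n≤m; ≤-totalOrder)
open import Data.List.Extrema ≤-totalOrder using (argmin; argmin-sel; f[argmin]≤f[xs])
open import Data.Product using (_,_; ∃; _×_; proj₁; proj₂)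
open import Data.Sum using (_⊎_; inj₁; inj₂; map₂)
open import Data.Vec using (Vec; []; _∷_; lookup; replicate)
open import Function using (_∘_; _$_; id; _⇔_; mk⇔; Equivalence)
open import Relation.Binary using (tri<; tri≈; tri>)
open import Relation.Binary.PropositionalEquality
open import Relation.Nullary using (Dec; does; yes; no; ¬_)
open import Relation.Nullary.Decidable using (does-⇔; _×-dec_)
open import Relation.Unary using (Decidable)

count : ∀ {A : Set} {P : A → Set} → Decidable P → List A → ℕ
count P? xs = length (filter P? xs)

count-⇔ : ∀ {A : Set} {P Q : A → Set} (P? : Decidable P) (Q? : Decidable Q) →
  (∀ {x} → P x → Q x) → (∀ {x} → Q x → P x) → ∀ xs → count P? xs ≡ count Q? xs
count-⇔ P? Q? P⇒Q Q⇒P xs = cong length (filter-≐ P? Q? (P⇒Q , Q⇒P) xs)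

count-map : ∀ {A B : Set} {P : B → Set} (P? : Decidable P) (h : A → B) xs →
  count P? (map h xs) ≡ count (P? ∘ h) xs
count-map P? h [] = refl
count-map P? h (x ∷ xs) with does (P? (h x))
... | true = cong suc (count-map P? h xs)
... | false = count-map P? h xs

count-concatMap : ∀ {A B : Set} {P : B → Set} (P? : Decidable P) (h : A → List B) xs →
  count P? (concatMap h xs) ≡ sum (map (count P? ∘ h) xs)
count-concatMap P? h [] = refl
count-concatMap P? h (x ∷ xs) = begin
  length (filter P? (h x ++ concatMap h xs))          ≡⟨ cong length (filter-++ P? (h x) _) ⟩
  length (filter P? (h x) ++ filter P? (concatMap h xs)) ≡⟨ length-++ (filter P? (h x)) ⟩
  count P? (h x) + count P? (concatMap h xs)            ≡⟨ cong (count P? (h x) +_) (count-concatMap P? h xs) ⟩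
  count P? (h x) + sum (map (count P? ∘ h) xs)         ∎
  where open ≡-Reasoning

sum-indicator : ∀ {A : Set} {Q : A → Set} (Q? : Decidable Q) (c : A → ℕ) k →
  (∀ x → c x ≡ (if does (Q? x) then k else 0)) → ∀ xs → sum (map c xs) ≡ count Q? xs * k
sum-indicator Q? c k c≡ [] = refl
sum-indicator Q? c k c≡ (x ∷ xs) rewrite c≡ x with does (Q? x)
... | true = cong (k +_) (sum-indicator Q? c k c≡ xs)
... | false = sum-indicator Q? c k c≡ xs

product-indicator : ∀ {A : Set} {Q : A → Set} (Q? : Decidable Q) (c : A → ℕ) a →
  (∀ x → c x ≡ (if does (Q? x) then a else 1)) → ∀ xs → product (map c xs) ≡ a ^ count Q? xs
product-indicator Q? c a c≡ [] = refl
product-indicator Q? c a c≡ (x ∷ xs) rewrite c≡ x with does (Q? x)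
... | true = cong (a *_) (product-indicator Q? c a c≡ xs)
... | false = trans (+-identityʳ _) (product-indicator Q? c a c≡ xs)

count-tabulate-all : ∀ {A : Set} {P : A → Set} (P? : Decidable P) {n} (h : Fin n → A) →
  (∀ i → P (h i)) → count P? (tabulate h) ≡ n
count-tabulate-all P? h all-P = trans (cong length (filter-all P? (tabulate⁺ all-P))) (length-tabulate h)

count-tabulate-none : ∀ {A : Set} {P : A → Set} (P? : Decidable P) {n} (h : Fin n → A) →
  (∀ i → ¬ P (h i)) → count P? (tabulate h) ≡ 0
count-tabulate-none P? h no-P = cong length (filter-none P? (tabulate⁺ no-P))

count-≟-allFin : ∀ {n} (b : Fin n) → count (_≟ b) (allFin n) ≡ 1
count-≟-allFin {suc n} zero = cong suc (count-tabulate-none (_≟ zero) {n} suc (λ i ()))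
count-≟-allFin {suc n} (suc b) = begin
  count (_≟ suc b) (tabulate suc)          ≡⟨ cong (count (_≟ suc b)) (sym (map-tabulate id suc)) ⟩
  count (_≟ suc b) (map suc (allFin n))    ≡⟨ count-map (_≟ suc b) suc (allFin n) ⟩
  count ((_≟ suc b) ∘ suc) (allFin n)      ≡⟨ count-⇔ _ (_≟ b) suc-injective (cong suc) (allFin n) ⟩
  count (_≟ b) (allFin n)                  ≡⟨ count-≟-allFin b ⟩
  1                                        ∎
  where open ≡-Reasoning

Satisfies : ∀ {A : Set} {n} → (Fin n → Vec A n → A → Set) → Vec A n → Set
Satisfies C f = ∀ j → C j f (lookup f j)

satisfies? : ∀ {A : Set} {n} {C : Fin n → Vec A n → A → Set} →
  (∀ j f → Decidable (C j f)) → Decidable (Satisfies C)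
satisfies? C? f = allFin? (λ j → C? j f (lookup f j))

Causal : ∀ {A : Set} {n} → (Fin n → Vec A n → A → Set) → Set
Causal {A} {n} C = ∀ j (f f′ : Vec A n) → (∀ i → toℕ i < toℕ j → lookup f i ≡ lookup f′ i) →
  ∀ x → C j f x → C j f′ x

-- Sequential choice: if coordinate j can always be chosen in c j ways from the
-- candidates as, whatever the earlier coordinates were, then there are
-- c 0 * ⋯ * c (n-1) vectors satisfying all constraints.  (The point a₀ only serves to
-- evaluate the first constraint, which depends on no coordinate.)
count-sequential : ∀ {A : Set} (a₀ : A) (as : List A) n {C : Fin n → Vec A n → A → Set}
  (C? : ∀ j f → Decidable (C j f)) (c : Fin n → ℕ) → Causal C →
  (∀ j f → count (C? j f) as ≡ c j) → count (satisfies? C?) (allVecs as n) ≡ product (tabulate c)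
count-sequential a₀ as zero C? c causal counts with satisfies? C? []
... | yes _ = refl
... | no ¬sat = ⊥-elim (¬sat (λ ()))
count-sequential {A} a₀ as (suc n) {C} C? c causal counts = begin
  count (satisfies? C?) (concatMap extensions as)
    ≡⟨ count-concatMap (satisfies? C?) extensions as ⟩
  sum (map (count (satisfies? C?) ∘ extensions) as)
    ≡⟨ sum-indicator (C? zero f₀) _ (product (tabulate (c ∘ suc))) count-extensions as ⟩
  count (C? zero f₀) as * product (tabulate (c ∘ suc))
    ≡⟨ cong (_* product (tabulate (c ∘ suc))) (counts zero f₀) ⟩
  product (tabulate c) ∎
  where
  open ≡-Reasoning
  V : List (Vec A n)
  V = allVecs as n
  extensions : A → List (Vec A (suc n))
  extensions b = map (b ∷_) V
  f₀ : Vec A (suc n)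
  f₀ = replicate (suc n) a₀

  Cᵇ : A → Fin n → Vec A n → A → Set
  Cᵇ b j v = C (suc j) (b ∷ v)
  causalᵇ : ∀ b → Causal (Cᵇ b)
  causalᵇ b j v v′ agree = causal (suc j) (b ∷ v) (b ∷ v′) agree′
    where
    agree′ : ∀ i → toℕ i < toℕ (suc j) → lookup (b ∷ v) i ≡ lookup (b ∷ v′) i
    agree′ zero _ = refl
    agree′ (suc i) (s≤s i<j) = agree i i<j
  first : ∀ b (v v′ : Vec A (suc n)) → C zero v b → C zero v′ b
  first b v v′ = causal zero v v′ (λ i ()) b

  count-extensions : ∀ b → count (satisfies? C?) (extensions b) ≡
    (if does (C? zero f₀ b) then product (tabulate (c ∘ suc)) else 0)
  count-extensions b with C? zero f₀ b
  ... | yes Cb = begin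
    count (satisfies? C?) (map (b ∷_) V)      ≡⟨ count-map (satisfies? C?) (b ∷_) V ⟩
    count (satisfies? C? ∘ (b ∷_)) V          ≡⟨ count-⇔ _ (satisfies? (λ j v → C? (suc j) (b ∷ v)))
                                                   (λ sat j → sat (suc j))
                                                   (λ { sat zero → first b f₀ _ Cb ; sat (suc j) → sat j }) V ⟩
    count (satisfies? (λ j v → C? (suc j) (b ∷ v))) V
                                              ≡⟨ count-sequential a₀ as n _ (c ∘ suc) (causalᵇ b) (λ j v → counts (suc j) (b ∷ v)) ⟩
    product (tabulate (c ∘ suc))              ∎
  ... | no ¬Cb = begin
    count (satisfies? C?) (map (b ∷_) V)      ≡⟨ count-map (satisfies? C?) (b ∷_) V ⟩
    count (satisfies? C? ∘ (b ∷_)) V          ≡⟨ cong length (filter-none (satisfies? C? ∘ (b ∷_))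
                                                   (universal (λ v sat → ¬Cb (first b _ f₀ (sat zero))) V)) ⟩
    0                                         ∎

iter-+ : ∀ {A : Set} (f : A → A) a b x → iter f (a + b) x ≡ iter f a (iter f b x)
iter-+ f zero b x = refl
iter-+ f (suc a) b x = cong f (iter-+ f a b x)

iter-* : ∀ {A : Set} (f : A → A) d L x → iter (iter f d) L x ≡ iter f (L * d) x
iter-* f d zero x = refl
iter-* f d (suc L) x = trans (cong (iter f d) (iter-* f d L x)) (sym (iter-+ f d (L * d) x))

iter-comm : ∀ {A : Set} (f : A → A) a b x → iter f a (iter f b x) ≡ iter f b (iter f a x)
iter-comm f a b x = begin
  iter f a (iter f b x) ≡⟨ sym (iter-+ f a b x) ⟩
  iter f (a + b) x      ≡⟨ cong (λ t → iter f t x) (+-comm a b) ⟩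
  iter f (b + a) x      ≡⟨ iter-+ f b a x ⟩
  iter f b (iter f a x) ∎
  where open ≡-Reasoning

iter-periodic : ∀ {A : Set} (f : A → A) L x → iter f L x ≡ x → ∀ q → iter f (q * L) x ≡ x
iter-periodic f L x per zero = refl
iter-periodic f L x per (suc q) =
  trans (iter-+ f L (q * L) x) (trans (cong (iter f L) (iter-periodic f L x per q)) per)

iter-mod : ∀ {A : Set} (f : A → A) L x .{{_ : NonZero L}} → iter f L x ≡ x →
  ∀ t → iter f t x ≡ iter f (t % L) x
iter-mod f L x per t = begin
  iter f t x                             ≡⟨ cong (λ s → iter f s x) (m≡m%n+[m/n]*n t L) ⟩
  iter f (t % L + (t / L) * L) x         ≡⟨ iter-+ f (t % L) ((t / L) * L) x ⟩
  iter f (t % L) (iter f ((t / L) * L) x) ≡⟨ cong (iter f (t % L)) (iter-periodic f L x per (t / L)) ⟩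
  iter f (t % L) x                       ∎
  where open ≡-Reasoning

iter-injective : ∀ {A : Set} (f : A → A) → (∀ {x y} → f x ≡ f y → x ≡ y) →
  ∀ t {x y} → iter f t x ≡ iter f t y → x ≡ y
iter-injective f inj zero eq = eq
iter-injective f inj (suc t) eq = iter-injective f inj t (inj eq)

shift-fixes-zero : ∀ N′ e → iter (g (suc N′)) e zero ≡ zero
shift-fixes-zero N′ zero = refl
shift-fixes-zero N′ (suc e) = cong (g (suc N′)) (shift-fixes-zero N′ e)

rotate : ∀ N′ → ℕ → Fin (suc N′) → Fin (suc N′)
rotate N′ e i = fromℕ< (m%n<n (toℕ i + e) (suc N′))

rotate-zero : ∀ N′ i → rotate N′ 0 i ≡ i
rotate-zero N′ i = toℕ-injective (begin
  toℕ (rotate N′ 0 i)    ≡⟨ toℕ-fromℕ< _ ⟩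
  (toℕ i + 0) % suc N′   ≡⟨ cong (_% suc N′) (+-identityʳ (toℕ i)) ⟩
  toℕ i % suc N′         ≡⟨ m<n⇒m%n≡m (toℕ<n i) ⟩
  toℕ i                  ∎)
  where open ≡-Reasoning

shift-rotate : ∀ N′ e i → g (suc N′) (suc (rotate N′ e i)) ≡ suc (rotate N′ (suc e) i)
shift-rotate N′ e i = cong suc (toℕ-injective (begin
  toℕ (fromℕ< (m%n<n (suc (toℕ (rotate N′ e i))) N))  ≡⟨ toℕ-fromℕ< _ ⟩
  suc (toℕ (rotate N′ e i)) % N                       ≡⟨ cong (λ z → suc z % N) (toℕ-fromℕ< _) ⟩
  (1 + (toℕ i + e) % N) % N                           ≡⟨ %-distribˡ-+ 1 ((toℕ i + e) % N) N ⟩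
  (1 % N + (toℕ i + e) % N % N) % N                   ≡⟨ cong (λ z → (1 % N + z) % N) (m%n%n≡m%n (toℕ i + e) N) ⟩
  (1 % N + (toℕ i + e) % N) % N                       ≡⟨ sym (%-distribˡ-+ 1 (toℕ i + e) N) ⟩
  (1 + (toℕ i + e)) % N                               ≡⟨ cong (_% N) (sym (+-suc (toℕ i) e)) ⟩
  (toℕ i + suc e) % N                                 ≡⟨ sym (toℕ-fromℕ< _) ⟩
  toℕ (rotate N′ (suc e) i)                           ∎))
  where
  open ≡-Reasoning
  N : ℕ
  N = suc N′

shift-iter : ∀ N′ e (i : Fin (suc N′)) → iter (g (suc N′)) e (suc i) ≡ suc (rotate N′ e i)
shift-iter N′ zero i = cong suc (sym (rotate-zero N′ i))
shift-iter N′ (suc e) i = trans (cong (g (suc N′)) (shift-iter N′ e i)) (shift-rotate N′ e i)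

rotate-fixed⇔ : ∀ N′ e i → rotate N′ e i ≡ i ⇔ suc N′ ∣ e
rotate-fixed⇔ N′ e i = mk⇔ to from
  where
  N : ℕ
  N = suc N′
  to : rotate N′ e i ≡ i → N ∣ e
  to fixed = divides ((toℕ i + e) / N) (+-cancelˡ-≡ (toℕ i) e _ (begin
    toℕ i + e                             ≡⟨ m≡m%n+[m/n]*n (toℕ i + e) N ⟩
    (toℕ i + e) % N + (toℕ i + e) / N * N ≡⟨ cong (_+ (toℕ i + e) / N * N) (trans (sym (toℕ-fromℕ< _)) (cong toℕ fixed)) ⟩
    toℕ i + (toℕ i + e) / N * N           ∎))
    where open ≡-Reasoning
  from : N ∣ e → rotate N′ e i ≡ i
  from (divides q refl) = toℕ-injective (begin
    toℕ (rotate N′ (q * N) i) ≡⟨ toℕ-fromℕ< _ ⟩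
    (toℕ i + q * N) % N       ≡⟨ [m+kn]%n≡m%n (toℕ i) q N ⟩
    toℕ i % N                 ≡⟨ m<n⇒m%n≡m (toℕ<n i) ⟩
    toℕ i                     ∎)
    where open ≡-Reasoning

count-shift-fixed : ∀ N′ e → count (λ x → iter (g (suc N′)) e x ≟ x) (allFin (suc (suc N′))) ≡
  (if does (suc N′ ∣? e) then suc (suc N′) else 1)
count-shift-fixed N′ e = begin
  count fixed? (zero ∷ tabulate suc)   ≡⟨ cong length (filter-accept fixed? (shift-fixes-zero N′ e)) ⟩
  suc (count fixed? (tabulate suc))    ≡⟨ fixed-in-[N] (suc N′ ∣? e) ⟩
  (if does (suc N′ ∣? e) then suc (suc N′) else 1) ∎
  where
  open ≡-Reasoning
  fixed? : ∀ x → Dec (iter (g (suc N′)) e x ≡ x)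
  fixed? x = iter (g (suc N′)) e x ≟ x
  fixed-suc⇔ : ∀ i → iter (g (suc N′)) e (suc i) ≡ suc i ⇔ suc N′ ∣ e
  fixed-suc⇔ i = mk⇔
    (λ fx → Equivalence.to (rotate-fixed⇔ N′ e i) (suc-injective (trans (sym (shift-iter N′ e i)) fx)))
    (λ N∣e → trans (shift-iter N′ e i) (cong suc (Equivalence.from (rotate-fixed⇔ N′ e i) N∣e)))
  fixed-in-[N] : (D : Dec (suc N′ ∣ e)) → suc (count fixed? (tabulate suc)) ≡ (if does D then suc (suc N′) else 1)
  fixed-in-[N] (yes N∣e) = cong suc $ count-tabulate-all fixed? suc (λ i → Equivalence.from (fixed-suc⇔ i) N∣e)
  fixed-in-[N] (no N∤e) = cong suc $ count-tabulate-none fixed? suc (λ i fx → N∤e (Equivalence.to (fixed-suc⇔ i) fx))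

-- If m = N / gcd(N, d) (with d > 0), then L·d is a multiple of N exactly when L is a
-- multiple of m: m is the additive order of d modulo N.
∣-scaled⇔∣-order : ∀ N d m L → 0 < d → m * gcd N d ≡ N → N ∣ L * d ⇔ m ∣ L
∣-scaled⇔∣-order N d m L d>0 m*G≡N = mk⇔ to from
  where
  G : ℕ
  G = gcd N d
  instance
    G≢0 : NonZero G
    G≢0 = ≢-nonZero (gcd[m,n]≢0 N d (inj₂ (λ d≡0 → <-irrefl (sym d≡0) d>0)))
  d′ : ℕ
  d′ = d / G
  d′*G≡d : d′ * G ≡ d
  d′*G≡d = m/n*n≡m (gcd[m,n]∣n N d)
  N/G≡m : N / G ≡ m
  N/G≡m = trans (cong (_/ G) (sym m*G≡N)) (m*n/n≡m m G)
  m⊥d′ : Coprime m d′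
  m⊥d′ = subst (λ z → Coprime z d′) N/G≡m (coprime-/gcd N d)
  L*d≡L*d′*G : L * d ≡ (L * d′) * G
  L*d≡L*d′*G = trans (cong (L *_) (sym d′*G≡d)) (sym (*-assoc L d′ G))
  to : N ∣ L * d → m ∣ L
  to N∣Ld = coprime-divisor m⊥d′ (subst (m ∣_) (*-comm L d′)
    (*-cancelʳ-∣ G (subst₂ _∣_ (sym m*G≡N) L*d≡L*d′*G N∣Ld)))
  from : m ∣ L → N ∣ L * d
  from m∣L = subst₂ _∣_ m*G≡N (sym L*d≡L*d′*G) (*-pres-∣ (∣-trans m∣L (m∣m*n d′)) (∣-refl {G}))

module Cycles {n : ℕ} (w : Permutation′ n) where

  w^ : ℕ → Fin n → Fin n
  w^ t = iter (app w) t

  w^-injective : ∀ t {x y} → w^ t x ≡ w^ t y → x ≡ y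
  w^-injective = iter-injective (app w) λ {x} {y} wx≡wy →
    trans (sym (inverseˡ w)) (trans (cong (w ⟨$⟩ˡ_) wx≡wy) (inverseˡ w))

  w^-cancel : ∀ a b j → a ≤ b → w^ a j ≡ w^ b j → w^ (b ∸ a) j ≡ j
  w^-cancel a b j a≤b eq = w^-injective a (begin
    w^ a (w^ (b ∸ a) j) ≡⟨ iter-comm (app w) a (b ∸ a) j ⟩
    w^ (b ∸ a) (w^ a j) ≡⟨ sym (iter-+ (app w) (b ∸ a) a j) ⟩
    w^ (b ∸ a + a) j    ≡⟨ cong (λ t → w^ t j) (m∸n+n≡m a≤b) ⟩
    w^ b j              ≡⟨ sym eq ⟩
    w^ a j              ∎)
    where open ≡-Reasoning

  -- Every point returns to itself within n steps (pigeonhole on w^0 j, …, w^n j).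
  returns : ∀ j → ∃ λ t → 1 ≤ t × t ≤ n × w^ t j ≡ j
  returns j with pigeonhole (n<1+n n) (λ (i : Fin (suc n)) → w^ (toℕ i) j)
  ... | a , b , a<b , eq = toℕ b ∸ toℕ a , m<n⇒0<n∸m a<b ,
    ≤-trans (m∸n≤m (toℕ b) (toℕ a)) (s≤s⁻¹ (toℕ<n b)) , w^-cancel (toℕ a) (toℕ b) j (<⇒≤ a<b) eq

  search-spec : ∀ j t fuel → let R = cycleLenFrom w j t fuel in
    t ≤ R × (∀ s → t ≤ s → s < R → w^ s j ≢ j) × (w^ R j ≡ j ⊎ R ≡ t + fuel)
  search-spec j t zero = ≤-refl , (λ s t≤s s<t → ⊥-elim (<-irrefl refl (≤-<-trans t≤s s<t))) , inj₂ (sym (+-identityʳ t))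
  search-spec j t (suc fuel) with iter (app w) t j ≟ j
  ... | yes returned = ≤-refl , (λ s t≤s s<t → ⊥-elim (<-irrefl refl (≤-<-trans t≤s s<t))) , inj₁ returned
  ... | no ¬returned with search-spec j (suc t) fuel
  ...   | t<R , none-before , found =
    <⇒≤ t<R , none-from-t , map₂ (λ R≡ → trans R≡ (sym (+-suc t fuel))) found
    where
    none-from-t : ∀ s → t ≤ s → s < cycleLenFrom w j (suc t) fuel → w^ s j ≢ j
    none-from-t s t≤s s<R with m≤n⇒m<n∨m≡n t≤s
    ... | inj₁ t<s = none-before s t<s s<R
    ... | inj₂ refl = ¬returned

  L : Fin n → ℕ
  L = cycleLen w

  L-positive : ∀ j → 1 ≤ L j
  L-positive j = proj₁ (search-spec j 1 n)

  L-minimal : ∀ j s → 1 ≤ s → s < L j → w^ s j ≢ j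
  L-minimal j = proj₁ (proj₂ (search-spec j 1 n))

  -- The search does not run out of fuel, since j returns to itself within n steps.
  L-bounded-returns : ∀ j → L j ≤ n × w^ (L j) j ≡ j
  L-bounded-returns j with returns j | proj₂ (proj₂ (search-spec j 1 n))
  ... | t , 1≤t , t≤n , returns-at-t | found = L≤n , returned found
    where
    L≤n : L j ≤ n
    L≤n with ≤-<-connex (L j) t
    ... | inj₁ L≤t = ≤-trans L≤t t≤n
    ... | inj₂ t<L = ⊥-elim (L-minimal j t 1≤t t<L returns-at-t)
    returned : w^ (L j) j ≡ j ⊎ L j ≡ 1 + n → w^ (L j) j ≡ j
    returned (inj₁ ret) = ret
    returned (inj₂ L≡1+n) = ⊥-elim (<-irrefl refl (subst (_≤ n) L≡1+n L≤n))

  L≤n : ∀ j → L j ≤ n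
  L≤n j = proj₁ (L-bounded-returns j)

  L-returns : ∀ j → w^ (L j) j ≡ j
  L-returns j = proj₂ (L-bounded-returns j)

  instance
    L-nonZero : ∀ {j} → NonZero (L j)
    L-nonZero {j} = >-nonZero (L-positive j)

  w^-mod : ∀ j t → w^ t j ≡ w^ (t % L j) j
  w^-mod j = iter-mod (app w) (L j) j (L-returns j)

  w^-distinct : ∀ j a b → a < L j → b < L j → w^ a j ≡ w^ b j → a ≡ b
  w^-distinct j a b a<L b<L eq with <-cmp a b
  ... | tri< a<b _ _ = ⊥-elim (L-minimal j (b ∸ a) (m<n⇒0<n∸m a<b) (≤-<-trans (m∸n≤m b a) b<L)
                                 (w^-cancel a b j (<⇒≤ a<b) eq))
  ... | tri≈ _ a≡b _ = a≡b
  ... | tri> _ _ b<a = ⊥-elim (L-minimal j (a ∸ b) (m<n⇒0<n∸m b<a) (≤-<-trans (m∸n≤m a b) a<L)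
                                 (w^-cancel b a j (<⇒≤ b<a) (sym eq)))

  exponents-agree : ∀ {A : Set} (G : A → A) y x → iter G (L y) x ≡ x →
    ∀ a b → w^ a y ≡ w^ b y → iter G a x ≡ iter G b x
  exponents-agree G y x periodic a b eq = begin
    iter G a x            ≡⟨ iter-mod G (L y) x periodic a ⟩
    iter G (a % L y) x    ≡⟨ cong (λ t → iter G t x) same-residue ⟩
    iter G (b % L y) x    ≡⟨ sym (iter-mod G (L y) x periodic b) ⟩
    iter G b x            ∎
    where
    open ≡-Reasoning
    same-residue : a % L y ≡ b % L y
    same-residue = w^-distinct y _ _ (m%n<n a (L y)) (m%n<n b (L y))
      (trans (sym (w^-mod y a)) (trans eq (w^-mod y b)))

  in-orbit : ∀ j t → w^ t j ∈ orbit w j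
  in-orbit j t = subst (_∈ orbit w j) (sym (w^-mod j t))
    (∈-applyUpTo⁺ (λ s → w^ s j) (≤-trans (m%n<n t (L j)) (L≤n j)))

  returns-from : ∀ j s → ∃ λ v → w^ v (w^ s j) ≡ j
  returns-from j s = (L j ∸ 1) * s , (begin
    w^ ((L j ∸ 1) * s) (w^ s j) ≡⟨ sym (iter-+ (app w) ((L j ∸ 1) * s) s j) ⟩
    w^ ((L j ∸ 1) * s + s) j    ≡⟨ cong (λ t → w^ t j) (pred*s+s≡s* (L j) s (L-positive j)) ⟩
    w^ (s * L j) j              ≡⟨ iter-periodic (app w) (L j) j (L-returns j) s ⟩
    j                           ∎)
    where
    open ≡-Reasoning
    pred*s+s≡s* : ∀ l s → 1 ≤ l → (l ∸ 1) * s + s ≡ s * l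
    pred*s+s≡s* (suc l) s _ = trans (+-comm (l * s) s) (trans (cong (s +_) (*-comm l s)) (sym (*-suc s l)))

  leader : Fin n → Fin n
  leader j = argmin toℕ j (orbit w j)

  leader-in-orbit : ∀ j → ∃ λ u → leader j ≡ w^ u j
  leader-in-orbit j with argmin-sel toℕ j (orbit w j)
  ... | inj₁ leader≡j = 0 , leader≡j
  ... | inj₂ leader∈orbit with ∈-applyUpTo⁻ (λ t → w^ t j) leader∈orbit
  ...   | u , _ , leader≡ = u , leader≡

  leader-minimal : ∀ j t → toℕ (leader j) ≤ toℕ (w^ t j)
  leader-minimal j t = All.lookup (f[argmin]≤f[xs] {f = toℕ} j (orbit w j)) (in-orbit j t)

  leader-invariant : ∀ j s → leader (w^ s j) ≡ leader j
  leader-invariant j s with leader-in-orbit j | leader-in-orbit (w^ s j) | returns-from j s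
  ... | u , ℓj≡ | u′ , ℓwj≡ | v , back = toℕ-injective (≤-antisym ℓwj≤ℓj ℓj≤ℓwj)
    where
    ℓwj≤ℓj : toℕ (leader (w^ s j)) ≤ toℕ (leader j)
    ℓwj≤ℓj = subst (λ z → toℕ (leader (w^ s j)) ≤ toℕ z)
      (sym (trans ℓj≡ (trans (cong (w^ u) (sym back)) (sym (iter-+ (app w) u v (w^ s j))))))
      (leader-minimal (w^ s j) (u + v))
    ℓj≤ℓwj : toℕ (leader j) ≤ toℕ (leader (w^ s j))
    ℓj≤ℓwj = subst (λ z → toℕ (leader j) ≤ toℕ z)
      (sym (trans ℓwj≡ (sym (iter-+ (app w) u′ s j))))
      (leader-minimal j (u′ + s))

  isLeader⇔ : ∀ j → isLeader w j ⇔ leader j ≡ j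
  isLeader⇔ j = mk⇔ to from
    where
    to : isLeader w j → leader j ≡ j
    to least with leader-in-orbit j
    ... | u , ℓ≡ = toℕ-injective (≤-antisym (leader-minimal j 0)
      (subst (λ z → toℕ j ≤ toℕ z) (sym ℓ≡) (All.lookup least (in-orbit j u))))
    from : leader j ≡ j → isLeader w j
    from ℓ≡j = All.tabulate λ x∈orbit → below x∈orbit
      where
      below : ∀ {x} → x ∈ orbit w j → toℕ j ≤ toℕ x
      below x∈orbit with ∈-applyUpTo⁻ (λ t → w^ t j) x∈orbit
      ... | t , _ , refl = subst (λ z → toℕ z ≤ toℕ (w^ t j)) ℓ≡j (leader-minimal j t)

  leader-isLeader : ∀ j → isLeader w (leader j)
  leader-isLeader j with leader-in-orbit j
  ... | u , ℓ≡ = Equivalence.from (isLeader⇔ (leader j)) (trans (cong leader ℓ≡) (leader-invariant j u))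

  leader-before : ∀ j → ¬ isLeader w j → toℕ (leader j) < toℕ j
  leader-before j not-leader with m≤n⇒m<n∨m≡n (leader-minimal j 0)
  ... | inj₁ ℓ<j = ℓ<j
  ... | inj₂ ℓ≡j = ⊥-elim (not-leader (Equivalence.from (isLeader⇔ j) (toℕ-injective ℓ≡j)))

  position : Fin n → ℕ
  position j = proj₁ (returns-from j (proj₁ (leader-in-orbit j)))

  position-spec : ∀ j → w^ (position j) (leader j) ≡ j
  position-spec j = trans (cong (w^ (position j)) (proj₂ (leader-in-orbit j)))
                          (proj₂ (returns-from j (proj₁ (leader-in-orbit j))))

module EquivariantCount {n K : ℕ} (w : Permutation′ n) (G : Fin (suc K) → Fin (suc K)) where
  open Cycles w

  A : Set
  A = Fin (suc K)

  fixCount : ℕ → ℕ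
  fixCount t = count (λ x → iter G t x ≟ x) (allFin (suc K))

  isLeader? : ∀ j → Dec (isLeader w j)
  isLeader? j = all? (λ x → toℕ j ≤? toℕ x) (orbit w j)

  -- The value at a leader must be G^(L j)-periodic; every other value is determined by
  -- the value at its leader.  (Indexed by the decision so that it computes.)
  Constraint : ∀ j → Dec (isLeader w j) → Vec A n → A → Set
  Constraint j (yes _) f x = iter G (L j) x ≡ x
  Constraint j (no _) f x = x ≡ iter G (position j) (lookup f (leader j))

  constraint? : ∀ j D f → Decidable (Constraint j D f)
  constraint? j (yes _) f x = iter G (L j) x ≟ x
  constraint? j (no _) f x = x ≟ iter G (position j) (lookup f (leader j))

  C : Fin n → Vec A n → A → Set
  C j = Constraint j (isLeader? j)

  C? : ∀ j f → Decidable (C j f)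
  C? j = constraint? j (isLeader? j)

  weight : Fin n → ℕ
  weight j = if does (isLeader? j) then fixCount (L j) else 1

  causal : Causal C
  causal j f f′ agree = causalᴰ (isLeader? j)
    where
    causalᴰ : ∀ D x → Constraint j D f x → Constraint j D f′ x
    causalᴰ (yes _) x periodic = periodic
    causalᴰ (no not-leader) x determined =
      trans determined (cong (iter G (position j)) (agree (leader j) (leader-before j not-leader)))

  counts : ∀ j f → count (C? j f) (allFin (suc K)) ≡ weight j
  counts j f = countsᴰ (isLeader? j)
    where
    countsᴰ : ∀ D → count (constraint? j D f) (allFin (suc K)) ≡ (if does D then fixCount (L j) else 1)
    countsᴰ (yes _) = refl
    countsᴰ (no _) = count-≟-allFin (iter G (position j) (lookup f (leader j)))

  module _ (f : Vec A n) where

    Commutes : Set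
    Commutes = ∀ j → lookup f (app w j) ≡ G (lookup f j)

    commutes-iter : Commutes → ∀ t y → lookup f (w^ t y) ≡ iter G t (lookup f y)
    commutes-iter comm zero y = refl
    commutes-iter comm (suc t) y = trans (comm (w^ t y)) (cong G (commutes-iter comm t y))

    commutes⇒satisfies : Commutes → Satisfies C f
    commutes⇒satisfies comm j = fromᴰ (isLeader? j)
      where
      fromᴰ : ∀ D → Constraint j D f (lookup f j)
      fromᴰ (yes _) = trans (sym (commutes-iter comm (L j) j)) (cong (lookup f) (L-returns j))
      fromᴰ (no _) = trans (cong (lookup f) (sym (position-spec j))) (commutes-iter comm (position j) (leader j))

    module _ (sat : Satisfies C f) where

      leader-periodic : ∀ j → iter G (L (leader j)) (lookup f (leader j)) ≡ lookup f (leader j)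
      leader-periodic j = periodicᴰ (isLeader? (leader j)) (sat (leader j))
        where
        periodicᴰ : ∀ D → Constraint (leader j) D f (lookup f (leader j)) →
          iter G (L (leader j)) (lookup f (leader j)) ≡ lookup f (leader j)
        periodicᴰ (yes _) periodic = periodic
        periodicᴰ (no not-leader) _ = ⊥-elim (not-leader (leader-isLeader j))

      from-leader : ∀ j → lookup f j ≡ iter G (position j) (lookup f (leader j))
      from-leader j = fromᴰ (isLeader? j) (sat j)
        where
        fromᴰ : ∀ D → Constraint j D f (lookup f j) → lookup f j ≡ iter G (position j) (lookup f (leader j))
        fromᴰ (yes is-leader) _ = trans (cong (lookup f) (sym ℓ≡j))
          (exponents-agree G (leader j) (lookup f (leader j)) (leader-periodic j) 0 (position j) (trans ℓ≡j (sym (position-spec j))))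
          where
          ℓ≡j : leader j ≡ j
          ℓ≡j = Equivalence.to (isLeader⇔ j) is-leader
        fromᴰ (no _) determined = determined

      satisfies⇒commutes : Commutes
      satisfies⇒commutes j = begin
        lookup f (app w j)                                      ≡⟨ from-leader (app w j) ⟩
        iter G (position (app w j)) (lookup f (leader (app w j))) ≡⟨ cong (λ y → iter G (position (app w j)) (lookup f y)) same-leader ⟩
        iter G (position (app w j)) (lookup f (leader j))       ≡⟨ exponents-agree G (leader j) (lookup f (leader j)) (leader-periodic j)
                                                                     (position (app w j)) (suc (position j)) same-point ⟩
        G (iter G (position j) (lookup f (leader j)))           ≡⟨ cong G (sym (from-leader j)) ⟩
        G (lookup f j)                                          ∎
        where
        open ≡-Reasoning
        same-leader : leader (app w j) ≡ leader j
        same-leader = leader-invariant j 1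
        same-point : w^ (position (app w j)) (leader j) ≡ w^ (suc (position j)) (leader j)
        same-point = begin
          w^ (position (app w j)) (leader j)         ≡⟨ cong (w^ (position (app w j))) (sym same-leader) ⟩
          w^ (position (app w j)) (leader (app w j)) ≡⟨ position-spec (app w j) ⟩
          app w j                                    ≡⟨ cong (app w) (sym (position-spec j)) ⟩
          w^ (suc (position j)) (leader j)           ∎

  count-commuting : count (λ f → all? (λ j → lookup f (app w j) ≟ G (lookup f j)) (allFin n))
                          (allVecs (allFin (suc K)) n)
                    ≡ product (tabulate weight)
  count-commuting = begin
    count (λ f → all? (λ j → lookup f (app w j) ≟ G (lookup f j)) (allFin n)) (allVecs (allFin (suc K)) n)
      ≡⟨ count-⇔ commutes? (satisfies? C?) (λ {f} comm → commutes⇒satisfies f (tabulate⁻ comm))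
                                          (λ {f} sat → tabulate⁺ (satisfies⇒commutes f sat)) vectors ⟩
    count (satisfies? C?) (allVecs (allFin (suc K)) n)
      ≡⟨ count-sequential zero (allFin (suc K)) n C? weight causal counts ⟩
    product (tabulate weight) ∎
    where
    open ≡-Reasoning
    vectors : List (Vec A n)
    vectors = allVecs (allFin (suc K)) n
    commutes? : ∀ f → Dec (All (λ j → lookup f (app w j) ≡ G (lookup f j)) (allFin n))
    commutes? f = all? (λ j → lookup f (app w j) ≟ G (lookup f j)) (allFin n)

shift-power-fixCount : ∀ N′ d m t → 0 < d → m * gcd (suc N′) d ≡ suc N′ →
  count (λ x → iter (gpow (suc N′) d) t x ≟ x) (allFin (suc (suc N′))) ≡
  (if does (m ∣? t) then suc (suc N′) else 1)
shift-power-fixCount N′ d m t d>0 order = begin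
  count (λ x → iter (gpow N d) t x ≟ x) (allFin (suc N))
    ≡⟨ count-⇔ (λ x → iter (gpow N d) t x ≟ x) (λ x → iter (g N) (t * d) x ≟ x)
               (trans (sym (iter-* (g N) d t _))) (trans (iter-* (g N) d t _)) (allFin (suc N)) ⟩
  count (λ x → iter (g N) (t * d) x ≟ x) (allFin (suc N))
    ≡⟨ count-shift-fixed N′ (t * d) ⟩
  (if does (N ∣? t * d) then suc N else 1)
    ≡⟨ cong (if_then suc N else 1) (does-⇔ (∣-scaled⇔∣-order N d m t d>0 order) (N ∣? t * d) (m ∣? t)) ⟩
  (if does (m ∣? t) then suc N else 1) ∎
  where
  open ≡-Reasoning
  N : ℕ
  N = suc N′

-- The theorem: by EquivariantCount the count is a product of weights, and by
-- shift-power-fixCount each weight is N + 1 at the leaders of cycles of length divisible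
-- by m and 1 elsewhere.  (n, k ≥ 1 make N = kn a successor, as the shift lemmas require.)
lemma8p2 : ∀ (n k : ℕ) (w : Permutation′ n) (d m : ℕ) →
    1 ≤ n → 1 ≤ k → 0 < d → d < k * n →
    m * gcd (k * n) d ≡ k * n →
    countEquiv (k * n) w d ≡ suc (k * n) ^ r m w
lemma8p2 n@(suc _) k@(suc _) w d m _ _ d>0 _ order = begin
  countEquiv N w d                      ≡⟨ count-commuting ⟩
  product (tabulate weight)             ≡⟨ cong product (sym (map-tabulate id weight)) ⟩
  product (map weight (allFin n))       ≡⟨ product-indicator cyclesCounted? weight (suc N) weight≡ (allFin n) ⟩
  suc N ^ r m w                         ∎
  where
  open ≡-Reasoning
  N : ℕ
  N = k * n
  open EquivariantCount w (gpow N d)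
  open Cycles w using (L)
  cyclesCounted? : ∀ j → Dec (isLeader w j × m ∣ L j)
  cyclesCounted? j = isLeader? j ×-dec (m ∣? L j)
  weight≡ : ∀ j → weight j ≡ (if does (cyclesCounted? j) then suc N else 1)
  weight≡ j with does (isLeader? j)
  ... | true = shift-power-fixCount _ d m (L j) d>0 order
  ... | false = refl
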